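{- Let $H$ be an $n$-vertex graph of maximum degree $\Delta$. Then there exists an orientation $D$ of the edges of $H$ such that (a) $d^+_D(u) \le \lfloor \Delta/2\rfloor + 1$ for every $u\in V(H)$; and (b) there exists a set $A\subseteq V(H)$ of size $|A| \ge \frac{n}{\Delta^2+1}$ such that $d^+_D(u) = 0$ for every $u\in A$.
   Context: $d^+_D(u)$ denotes the out-degree of $u$ in the oriented graph $D$. -}

module Defs where

open import Data.Nat using (ℕ; _+_; _*_; _⊔_; _≤_; _/_; _^_)
open import Data.Bool using (Bool; true; false; if_then_else_; _xor_)
open import Data.Fin using (Fin)
open import Data.List using (List; map; foldr; allFin)
open import Data.Nat.ListAction using (sum)
open import Data.Fin.Subset using (Subset; _∈_; ∣_∣)
open import Relation.Binary.PropositionalEquality using (_≡_)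

record Graph (n : ℕ) : Set where
  field
    adj   : Fin n → Fin n → Bool
    sym   : ∀ u v → adj u v ≡ adj v u
    irref : ∀ u → adj u u ≡ false
open Graph public

countTrue : {n : ℕ} → (Fin n → Bool) → ℕ
countTrue {n} p = sum (map (λ v → if p v then 1 else 0) (allFin n))

degree : {n : ℕ} → Graph n → Fin n → ℕ
degree H u = countTrue (adj H u)

maxDegree : {n : ℕ} → Graph n → ℕ
maxDegree {n} H = foldr _⊔_ 0 (map (degree H) (allFin n))

record Orientation {n : ℕ} (H : Graph n) : Set where
  field
    arc        : Fin n → Fin n → Bool
    arc⇒edge   : ∀ u v → arc u v ≡ true → adj H u v ≡ true
    edge⇒one   : ∀ u v → adj H u v ≡ true → (arc u v xor arc v u) ≡ true
open Orientation public

outDegree : {n : ℕ} {H : Graph n} → Orientation H → Fin n → ℕ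
outDegree D u = countTrue (arc D u)

module Submission where

open import Data.Bool using (Bool; true; false; if_then_else_; _∧_; _∨_; not; _xor_)
open import Data.Bool.Properties renaming (_≟_ to _≟ᵇ_)
  using ( ∧-comm; ∨-comm; ∧-zeroʳ; ∨-zeroʳ; ∧-identityʳ; ∨-identityʳ; xor-identityʳ
        ; ∧-conicalˡ; ∧-conicalʳ; ∨-conicalˡ; ∨-conicalʳ)
open import Data.Fin using (Fin; zero; suc)
open import Data.Fin.Properties using (_≟_; suc-injective; any?)
  renaming (_<?_ to _<ᶠ?_; <-cmp to <ᶠ-cmp; <-asym to <ᶠ-asym)
open import Data.Fin.Subset using (_∈_; ∣_∣)
open import Data.List using (foldr; foldl; tabulate; allFin; _∷_; [])
import Data.List.Membership.Propositional as List
open import Data.List.Membership.Propositional.Properties using (∈-allFin; ∈-map⁺)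
open import Data.List.Properties using (map-tabulate)
open import Data.List.Relation.Unary.Any using (here; there)
open import Data.Nat
  using (ℕ; zero; suc; _+_; _*_; _∸_; _≤_; _<_; z≤n; s≤s; s≤s⁻¹; _≤?_; _<?_; _/_; _^_; _⊔_)
open import Data.Nat.DivMod using (m*n/n≡m; /-monoˡ-≤; m/n≡1+[m∸n]/n)
import Data.Nat.ListAction as List
open import Data.Nat.Properties hiding (_≟_; suc-injective; _<?_)
open import Algebra.Properties.CommutativeSemigroup +-commutativeSemigroup using (interchange; xy∙z≈xz∙y)
open import Algebra.Properties.Semiring.Sum +-*-semiring
  using (sum; sum-syntax; sum-cong-≗; sum-replicate-zero; *-distribˡ-sum; *-distribʳ-sum)
open import Data.Product using (Σ; Σ-syntax; ∃-syntax; _×_; _,_; proj₁; proj₂)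
open import Data.Sum using (_⊎_; inj₁; inj₂; [_,_]′)
open import Data.Vec using () renaming (tabulate to tabulateᵛ)
open import Data.Vec.Properties using ([]=⇒lookup; lookup∘tabulate)
open import Function using (_∘_; id; _⟨_⟩_)
open import Relation.Binary.Definitions using (tri<; tri≈; tri>)
open import Relation.Binary.PropositionalEquality
open import Relation.Nullary using (¬_; Dec; does; yes; no; contradiction)
open import Relation.Nullary.Decidable using (dec-true; dec-false; _×-dec_; _⊎-dec_)
open import Defs renaming (sym to adj-sym)

-- Greedily choose a maximal set A of vertices at pairwise distance at least 3. Every vertex is
-- within distance 2 of A and a ball of radius 2 has at most Δ² + 1 vertices, so |A|(Δ² + 1) ≥ n.
-- Orient H − A so that 2 d⁺(v) ≤ d(v) + 1 everywhere: while some vertex u violates this, the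
-- vertices reachable from u along arcs must contain one with spare room (otherwise, as no arc
-- leaves that set, it would carry more out-arcs than edges), and reversing a path to it lowers the
-- total excess. Finally orient every edge at A towards A. Vertices of A become sinks; any other
-- vertex has at most one neighbour in A, which costs it one out-arc but also removes an edge from
-- H − A, so its out-degree is at most ⌊Δ/2⌋ + 1.

private variable n m : ℕ

sum-mono-≤ : {f g : Fin n → ℕ} → (∀ i → f i ≤ g i) → sum f ≤ sum g
sum-mono-≤ {zero}  f≤g = z≤n
sum-mono-≤ {suc n} f≤g = +-mono-≤ (f≤g zero) (sum-mono-≤ (f≤g ∘ suc))

sum-mono-< : {f g : Fin n → ℕ} → (∀ i → f i ≤ g i) → ∀ j → f j < g j → sum f < sum g
sum-mono-< f≤g zero    fj<gj = +-mono-<-≤ fj<gj (sum-mono-≤ (f≤g ∘ suc))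
sum-mono-< f≤g (suc j) fj<gj = +-mono-≤-< (f≤g zero) (sum-mono-< (f≤g ∘ suc) j fj<gj)

≤-sum : (f : Fin n → ℕ) (i : Fin n) → f i ≤ sum f
≤-sum f zero    = m≤m+n _ _
≤-sum f (suc i) = ≤-trans (≤-sum (f ∘ suc) i) (m≤n+m _ _)

sum-zero : {f : Fin n → ℕ} → (∀ i → f i ≡ 0) → sum f ≡ 0
sum-zero {n} f≡0 = trans (sum-cong-≗ f≡0) (sum-replicate-zero n)

sum-ones : ∀ n → ∑[ i < n ] 1 ≡ n
sum-ones zero    = refl
sum-ones (suc n) = cong suc (sum-ones n)

sum-single : (f : Fin n → ℕ) (a : Fin n) → (∀ i → ¬ i ≡ a → f i ≡ 0) → sum f ≡ f a
sum-single f zero    f≡0 = trans (cong (f zero +_) (sum-zero (λ i → f≡0 (suc i) λ ()))) (+-identityʳ _)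
sum-single f (suc a) f≡0 = cong₂ _+_ (f≡0 zero λ ()) (sum-single (f ∘ suc) a
  (λ i i≢a → f≡0 (suc i) (i≢a ∘ suc-injective)))

sum-distrib-+ : (f g : Fin n → ℕ) → ∑[ i < n ] (f i + g i) ≡ sum f + sum g
sum-distrib-+ {zero}  f g = refl
sum-distrib-+ {suc n} f g = trans (cong ((f zero + g zero) +_) (sum-distrib-+ (f ∘ suc) (g ∘ suc)))
  (interchange (f zero) (g zero) (sum (f ∘ suc)) (sum (g ∘ suc)))

sum-swap : (f : Fin m → Fin n → ℕ) → ∑[ i < m ] ∑[ j < n ] f i j ≡ ∑[ j < n ] ∑[ i < m ] f i j
sum-swap {zero} {n} f = sym (sum-zero {n} (λ _ → refl))
sum-swap {suc m} {n} f = trans (cong (sum (f zero) +_) (sum-swap (f ∘ suc)))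
  (sym (sum-distrib-+ (f zero) (λ j → ∑[ i < m ] f (suc i) j)))

𝟙 : Bool → ℕ
𝟙 b = if b then 1 else 0

𝟙≤1 : ∀ b → 𝟙 b ≤ 1
𝟙≤1 true  = s≤s z≤n
𝟙≤1 false = z≤n

card : (Fin n → Bool) → ℕ
card {n} p = ∑[ i < n ] 𝟙 (p i)

𝟙-∨≤ : ∀ p q → 𝟙 (p ∨ q) ≤ 𝟙 p + 𝟙 q
𝟙-∨≤ true  _ = s≤s z≤n
𝟙-∨≤ false _ = ≤-refl

card-∨≤ : (p q : Fin n → Bool) → card (λ x → p x ∨ q x) ≤ card p + card q
card-∨≤ p q =
  ≤-trans (sum-mono-≤ (λ x → 𝟙-∨≤ (p x) (q x))) (≤-reflexive (sum-distrib-+ (𝟙 ∘ p) (𝟙 ∘ q)))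

_==_ : ∀ {n} → Fin n → Fin n → Bool
i == j = does (i ≟ j)

==-refl : ∀ {n} (i : Fin n) → (i == i) ≡ true
==-refl i = dec-true (i ≟ i) refl

==-≢ : ∀ {n} {i j : Fin n} → ¬ i ≡ j → (i == j) ≡ false
==-≢ {i = i} {j} = dec-false (i ≟ j)

==-false⇒≢ : ∀ {n} {i j : Fin n} → (i == j) ≡ false → ¬ i ≡ j
==-false⇒≢ {i = i} e refl with () ← trans (sym (==-refl i)) e

==⇒≡ : ∀ {n} {i j : Fin n} → (i == j) ≡ true → i ≡ j
==⇒≡ {i = i} {j} e with i ≟ j
... | yes i≡j = i≡j
==⇒≡ () | no _

card-∧== : ∀ {n} (p : Fin n → Bool) (c : Fin n) → card (λ y → p y ∧ y == c) ≡ 𝟙 (p c)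
card-∧== p c = trans (sum-single _ c elsewhere)
  (cong (λ t → 𝟙 (p c ∧ t)) (==-refl c) ⟨ trans ⟩ cong 𝟙 (∧-identityʳ (p c)))
  where
  elsewhere : ∀ y → ¬ y ≡ c → 𝟙 (p y ∧ y == c) ≡ 0
  elsewhere y y≢c = cong (λ t → 𝟙 (p y ∧ t)) (==-≢ y≢c) ⟨ trans ⟩ cong 𝟙 (∧-zeroʳ (p y))

card-== : ∀ {n} (c : Fin n) → card (_== c) ≡ 1
card-== = card-∧== (λ _ → true)

xor-cancelʳ : ∀ p q s → ((p xor s) xor (q xor s)) ≡ (p xor q)
xor-cancelʳ true  true  true  = refl
xor-cancelʳ true  true  false = refl
xor-cancelʳ true  false true  = refl
xor-cancelʳ true  false false = refl
xor-cancelʳ false true  true  = refl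
xor-cancelʳ false true  false = refl
xor-cancelʳ false false true  = refl
xor-cancelʳ false false false = refl

𝟙-xor : ∀ p q → 𝟙 (p xor q) + 𝟙 (p ∧ q) ≡ 𝟙 p + 𝟙 (not p ∧ q)
𝟙-xor true  true  = refl
𝟙-xor true  false = refl
𝟙-xor false true  = refl
𝟙-xor false false = refl

∨-≡true : ∀ {p q} → (p ∨ q) ≡ true → p ≡ true ⊎ q ≡ true
∨-≡true {true}  _ = inj₁ refl
∨-≡true {false} q = inj₂ q

card-toggle : ∀ {n} (p : Fin n → Bool) (c : Fin n) →
              card (λ y → p y xor (y == c)) + 𝟙 (p c) ≡ card p + 𝟙 (not (p c))
card-toggle {n} p c = begin
  card (λ y → p y xor (y == c)) + 𝟙 (p c)
    ≡⟨ cong (card (λ y → p y xor (y == c)) +_) (card-∧== p c) ⟨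
  card (λ y → p y xor (y == c)) + card (λ y → p y ∧ y == c)
    ≡⟨ sum-distrib-+ (λ y → 𝟙 (p y xor (y == c))) (λ y → 𝟙 (p y ∧ y == c)) ⟨
  ∑[ y < n ] (𝟙 (p y xor (y == c)) + 𝟙 (p y ∧ y == c))
    ≡⟨ sum-cong-≗ (λ y → 𝟙-xor (p y) (y == c)) ⟩
  ∑[ y < n ] (𝟙 (p y) + 𝟙 (not (p y) ∧ y == c))
    ≡⟨ sum-distrib-+ (λ y → 𝟙 (p y)) (λ y → 𝟙 (not (p y) ∧ y == c)) ⟩
  card p + card (λ y → not (p y) ∧ y == c)
    ≡⟨ cong (card p +_) (card-∧== (not ∘ p) c) ⟩
  card p + 𝟙 (not (p c)) ∎
  where open ≡-Reasoning

card< : ∀ {n} (S : Fin n → Bool) {w} → S w ≡ false → card S < n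
card< {n} S {w} Sw = subst (card S <_) (sum-ones n)
  (sum-mono-< (λ z → 𝟙≤1 (S z)) w (subst (λ b → 𝟙 b < 1) (sym Sw) (s≤s z≤n)))

card-insert : ∀ {n} (S : Fin n → Bool) {w} → S w ≡ false → card (λ z → S z ∨ z == w) ≡ suc (card S)
card-insert {n} S {w} Sw = begin
  card (λ z → S z ∨ z == w)            ≡⟨ sum-cong-≗ 𝟙-∨ ⟩
  ∑[ z < n ] (𝟙 (S z) + 𝟙 (z == w))    ≡⟨ sum-distrib-+ (𝟙 ∘ S) (λ z → 𝟙 (z == w)) ⟩
  card S + card (_== w)                ≡⟨ cong (card S +_) (card-== w) ⟩
  card S + 1                           ≡⟨ +-comm (card S) 1 ⟩
  suc (card S)                         ∎
  where
  open ≡-Reasoning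
  𝟙-∨ : ∀ z → 𝟙 (S z ∨ z == w) ≡ 𝟙 (S z) + 𝟙 (z == w)
  𝟙-∨ z with z ≟ w
  ... | yes refl rewrite Sw = refl
  ... | no _     = trans (cong 𝟙 (∨-identityʳ (S z))) (sym (+-identityʳ _))

card≤1 : ∀ {n} (p : Fin n → Bool) → (∀ x y → p x ≡ true → p y ≡ true → x ≡ y) → card p ≤ 1
card≤1 p unique with any? (λ x → p x ≟ᵇ true)
... | yes (x , px) = ≤-reflexive (sum-single (𝟙 ∘ p) x outside ⟨ trans ⟩ cong 𝟙 px)
  where
  outside : ∀ y → ¬ y ≡ x → 𝟙 (p y) ≡ 0
  outside y y≢x with p y in py
  ... | true  = contradiction (unique y x py px) y≢x
  ... | false = refl
... | no ∄x = ≤-trans (≤-reflexive (sum-zero absent)) z≤n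
  where
  absent : ∀ y → 𝟙 (p y) ≡ 0
  absent y with p y in py
  ... | true  = contradiction (y , py) ∄x
  ... | false = refl

double-count : (A : Fin n → Bool) (R : Fin n → Fin n → Bool) {B : ℕ} →
               (∀ x → ∃[ a ] A a ≡ true × R a x ≡ true) → (∀ a → card (R a) ≤ B) → n ≤ card A * B
double-count {n} A R {B} covered bounded = begin
  n                                    ≡⟨ sum-ones n ⟨
  ∑[ x < n ] 1                         ≤⟨ sum-mono-≤ hit ⟩
  ∑[ x < n ] ∑[ a < n ] incidence a x  ≡⟨ sum-swap (λ x a → incidence a x) ⟩
  ∑[ a < n ] ∑[ x < n ] incidence a x  ≡⟨ sum-cong-≗ (λ a → *-distribˡ-sum (𝟙 (A a)) (𝟙 ∘ R a)) ⟨
  ∑[ a < n ] (𝟙 (A a) * card (R a))    ≤⟨ sum-mono-≤ (λ a → *-monoʳ-≤ (𝟙 (A a)) (bounded a)) ⟩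
  ∑[ a < n ] (𝟙 (A a) * B)             ≡⟨ *-distribʳ-sum B (𝟙 ∘ A) ⟨
  card A * B                           ∎
  where
  open ≤-Reasoning
  incidence : Fin n → Fin n → ℕ
  incidence a x = 𝟙 (A a) * 𝟙 (R a x)
  hit : ∀ x → 1 ≤ ∑[ a < n ] incidence a x
  hit x = let a , Aa , Rax = covered x in
    ≤-trans (subst₂ (λ p q → 1 ≤ 𝟙 p * 𝟙 q) (sym Aa) (sym Rax) ≤-refl) (≤-sum (λ a → incidence a x) a)

sum-tabulate : (f : Fin n → ℕ) → List.sum (tabulate f) ≡ sum f
sum-tabulate {zero}  f = refl
sum-tabulate {suc n} f = cong (f zero +_) (sum-tabulate (f ∘ suc))

countTrue≡card : (p : Fin n → Bool) → countTrue p ≡ card p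
countTrue≡card p = trans (cong List.sum (map-tabulate id (𝟙 ∘ p))) (sum-tabulate (𝟙 ∘ p))

∣tabulateᵛ∣ : ∀ {n} (f : Fin n → Bool) → ∣ tabulateᵛ f ∣ ≡ card f
∣tabulateᵛ∣ {zero}  f = refl
∣tabulateᵛ∣ {suc n} f with f zero
... | true  = cong suc (∣tabulateᵛ∣ (f ∘ suc))
... | false = ∣tabulateᵛ∣ (f ∘ suc)

-- Orientations and arc reversal

deg : ∀ {n} → Graph n → Fin n → ℕ
deg G u = card (adj G u)

≤-foldr-⊔ : ∀ {x xs} → x List.∈ xs → x ≤ foldr _⊔_ 0 xs
≤-foldr-⊔ (here refl)  = m≤m⊔n _ _
≤-foldr-⊔ (there x∈xs) = ≤-trans (≤-foldr-⊔ x∈xs) (m≤n⊔m _ _)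

deg≤maxDegree : ∀ {n} (H : Graph n) u → deg H u ≤ maxDegree H
deg≤maxDegree H u =
  subst (_≤ maxDegree H) (countTrue≡card (adj H u)) (≤-foldr-⊔ (∈-map⁺ (degree H) (∈-allFin u)))

module _ {n : ℕ} {G : Graph n} where

  adj⇒≢ : ∀ {u v} → adj G u v ≡ true → ¬ u ≡ v
  adj⇒≢ {u} uv refl with () ← trans (sym uv) (irref G u)

  arc-asym : (D : Orientation G) → ∀ {u v} → arc D u v ≡ true → arc D v u ≡ false
  arc-asym D {u} {v} uv with arc D v u | edge⇒one D u v (arc⇒edge D u v uv)
  ... | false | _ = refl
  ... | true  | one rewrite uv with () ← one

  𝟙-adj : (D : Orientation G) → ∀ u v → 𝟙 (adj G u v) ≡ 𝟙 (arc D u v) + 𝟙 (arc D v u)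
  𝟙-adj D u v with adj G u v in uv | arc D u v in a₁ | arc D v u in a₂
  ... | true  | true  | true  with () ← trans (sym (cong₂ _xor_ a₁ a₂)) (edge⇒one D u v uv)
  ... | true  | true  | false = refl
  ... | true  | false | true  = refl
  ... | true  | false | false with () ← trans (sym (cong₂ _xor_ a₁ a₂)) (edge⇒one D u v uv)
  ... | false | true  | _     with () ← trans (sym uv) (arc⇒edge D u v a₁)
  ... | false | false | true  with () ← trans (sym uv) (trans (adj-sym G u v) (arc⇒edge D v u a₂))
  ... | false | false | false = refl

  sameEdge : Fin n → Fin n → Fin n → Fin n → Bool
  sameEdge a b x y = (x == a ∧ y == b) ∨ (x == b ∧ y == a)

  sameEdge-sym : ∀ a b x y → sameEdge a b x y ≡ sameEdge a b y x
  sameEdge-sym a b x y =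
    trans (∨-comm (x == a ∧ y == b) _) (cong₂ _∨_ (∧-comm (x == b) _) (∧-comm (x == a) _))

  sameEdge⇒adj : ∀ {a b} → adj G a b ≡ true → ∀ x y → sameEdge a b x y ≡ true → adj G x y ≡ true
  sameEdge⇒adj {a} {b} ab x y e with x ≟ a | y ≟ b | x ≟ b | y ≟ a
  ... | yes refl | yes refl | _        | _        = ab
  ... | _        | _        | yes refl | yes refl = trans (adj-sym G b a) ab
  sameEdge⇒adj ab x y () | yes _ | no _ | yes _ | no _
  sameEdge⇒adj ab x y () | yes _ | no _ | no _  | _
  sameEdge⇒adj ab x y () | no _  | _    | yes _ | no _
  sameEdge⇒adj ab x y () | no _  | _    | no _  | _

  reverse : (D : Orientation G) (a b : Fin n) → arc D a b ≡ true → Orientation G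
  reverse D a b ab = record
    { arc      = λ x y → arc D x y xor sameEdge a b x y
    ; arc⇒edge = reversed⇒edge
    ; edge⇒one = λ x y xy → begin
        (arc D x y xor sameEdge a b x y) xor (arc D y x xor sameEdge a b y x)
          ≡⟨ cong (λ s → (arc D x y xor sameEdge a b x y) xor (arc D y x xor s)) (sameEdge-sym a b x y) ⟨
        (arc D x y xor sameEdge a b x y) xor (arc D y x xor sameEdge a b x y)
          ≡⟨ xor-cancelʳ (arc D x y) (arc D y x) (sameEdge a b x y) ⟩
        arc D x y xor arc D y x
          ≡⟨ edge⇒one D x y xy ⟩
        true ∎
    }
    where
    open ≡-Reasoning
    reversed⇒edge : ∀ x y → (arc D x y xor sameEdge a b x y) ≡ true → adj G x y ≡ true
    reversed⇒edge x y e with sameEdge a b x y in s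
    ... | true  = sameEdge⇒adj (arc⇒edge D a b ab) x y s
    ... | false = arc⇒edge D x y (trans (sym (xor-identityʳ (arc D x y))) e)

  out : Orientation G → Fin n → ℕ
  out D u = card (arc D u)

  out-reverse : (D : Orientation G) (a b : Fin n) (ab : arc D a b ≡ true) →
                ∀ z → out (reverse D a b ab) z + 𝟙 (z == a) ≡ out D z + 𝟙 (z == b)
  out-reverse D a b ab z with z ≟ a | z ≟ b
  ... | yes refl | yes refl = contradiction refl (adj⇒≢ (arc⇒edge D a b ab))
  ... | yes refl | no _     = begin
    card (λ y → arc D a y xor (y == b ∨ false)) + 1
      ≡⟨ cong (_+ 1) (sum-cong-≗ (λ y → cong (λ s → 𝟙 (arc D a y xor s)) (∨-identityʳ (y == b)))) ⟩
    card (λ y → arc D a y xor (y == b)) + 1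
      ≡⟨ cong (λ t → card (λ y → arc D a y xor (y == b)) + 𝟙 t) ab ⟨
    card (λ y → arc D a y xor (y == b)) + 𝟙 (arc D a b)
      ≡⟨ card-toggle (arc D a) b ⟩
    out D a + 𝟙 (not (arc D a b))
      ≡⟨ cong (λ t → out D a + 𝟙 (not t)) ab ⟩
    out D a + 0 ∎
    where open ≡-Reasoning
  ... | no _   | yes refl = begin
    card (λ y → arc D b y xor (y == a)) + 0
      ≡⟨ cong (λ t → card (λ y → arc D b y xor (y == a)) + 𝟙 t) (arc-asym D ab) ⟨
    card (λ y → arc D b y xor (y == a)) + 𝟙 (arc D b a)
      ≡⟨ card-toggle (arc D b) a ⟩
    out D b + 𝟙 (not (arc D b a))
      ≡⟨ cong (λ t → out D b + 𝟙 (not t)) (arc-asym D ab) ⟩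
    out D b + 1 ∎
    where open ≡-Reasoning
  ... | no _   | no _     = cong (_+ 0) (sum-cong-≗ (λ y → cong 𝟙 (xor-identityʳ (arc D z y))))

  reverse-fixes : ∀ D a b ab x {y} → ¬ y ≡ a → ¬ y ≡ b → arc (reverse D a b ab) x y ≡ arc D x y
  reverse-fixes D a b ab x {y} y≢a y≢b = trans
    (cong (arc D x y xor_) (cong₂ _∨_ (cong (x == a ∧_) (==-≢ y≢b) ⟨ trans ⟩ ∧-zeroʳ (x == a))
                                      (cong (x == b ∧_) (==-≢ y≢a) ⟨ trans ⟩ ∧-zeroʳ (x == b))))
    (xor-identityʳ (arc D x y))

  -- D with a directed path from u to v reversed: u loses one out-arc, v gains one, and only arcs
  -- entering vertices of S change.
  record Reversal (D : Orientation G) (S : Fin n → Bool) (u v : Fin n) : Set where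
    field
      reversed      : Orientation G
      fixes-outside : ∀ x y → S y ≡ false → arc reversed x y ≡ arc D x y
      out-reversed  : ∀ z → out reversed z + 𝟙 (z == u) ≡ out D z + 𝟙 (z == v)
  open Reversal public

  reversal-refl : ∀ D S u → Reversal D S u u
  reversal-refl D S u = record { reversed = D ; fixes-outside = λ _ _ _ → refl ; out-reversed = λ _ → refl }

  reversal-weaken : ∀ {D S S′ u v} → (∀ y → S′ y ≡ false → S y ≡ false) →
                    Reversal D S u v → Reversal D S′ u v
  reversal-weaken S′⊆S R = record
    { reversed      = reversed R
    ; fixes-outside = λ x y S′y → fixes-outside R x y (S′⊆S y S′y)
    ; out-reversed  = out-reversed R
    }

  reversal-extend : ∀ {D S u v w} → Reversal D S u v → S v ≡ true → arc D v w ≡ true → S w ≡ false →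
                    Reversal D (λ z → S z ∨ z == w) u w
  reversal-extend {D} {S} {u} {v} {w} R Sv vw Sw = record
    { reversed      = reverse (reversed R) v w vw′
    ; fixes-outside = fixes
    ; out-reversed  = λ z → +-cancelʳ-≡ _ _ _ (begin
        out R′ z + 𝟙 (z == u) + 𝟙 (z == v)            ≡⟨ xy∙z≈xz∙y (out R′ z) _ _ ⟩
        out R′ z + 𝟙 (z == v) + 𝟙 (z == u)            ≡⟨ cong (_+ 𝟙 (z == u)) (out-reverse (reversed R) v w vw′ z) ⟩
        out (reversed R) z + 𝟙 (z == w) + 𝟙 (z == u)  ≡⟨ xy∙z≈xz∙y (out (reversed R) z) _ _ ⟩
        out (reversed R) z + 𝟙 (z == u) + 𝟙 (z == w)  ≡⟨ cong (_+ 𝟙 (z == w)) (out-reversed R z) ⟩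
        out D z + 𝟙 (z == v) + 𝟙 (z == w)             ≡⟨ xy∙z≈xz∙y (out D z) _ _ ⟩
        out D z + 𝟙 (z == w) + 𝟙 (z == v)             ∎)
    }
    where
    open ≡-Reasoning
    vw′ : arc (reversed R) v w ≡ true
    vw′ = trans (fixes-outside R v w Sw) vw
    R′ = reverse (reversed R) v w vw′
    fixes : ∀ x y → (S y ∨ y == w) ≡ false → arc R′ x y ≡ arc D x y
    fixes x y e = trans (reverse-fixes (reversed R) v w vw′ x y≢v (==-false⇒≢ y≠w)) (fixes-outside R x y Sy)
      where
      Sy = ∨-conicalˡ (S y) (y == w) e
      y≠w = ∨-conicalʳ (S y) (y == w) e
      y≢v : ¬ y ≡ v
      y≢v refl with () ← trans (sym Sy) Sv

  Explored : Orientation G → Fin n → (Fin n → Bool) → Set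
  Explored D u S = S u ≡ true × (∀ v → S v ≡ true → Reversal D S u v)

  Closed : Orientation G → (Fin n → Bool) → Set
  Closed D S = ∀ v w → S v ≡ true → arc D v w ≡ true → S w ≡ true

  explored-singleton : ∀ D u → Explored D u (_== u)
  explored-singleton D u =
    ==-refl u , λ v v≡u → subst (Reversal D (_== u) u) (sym (==⇒≡ v≡u)) (reversal-refl D _ u)

  explore : ∀ {D u} k S → Explored D u S → n ≤ card S + k →
            Σ[ S′ ∈ (Fin n → Bool) ] Explored D u S′ × Closed D S′
  explore {D} k S ex n≤
    with any? (λ v → any? (λ w → (S v ≟ᵇ true) ×-dec (arc D v w ≟ᵇ true) ×-dec (S w ≟ᵇ false)))
  ... | no ∄leaving = S , ex , closed
    where
    closed : Closed D S
    closed v w Sv vw with S w in Sw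
    ... | true  = refl
    ... | false = contradiction (v , w , Sv , vw , Sw) ∄leaving
  explore zero S ex n≤ | yes (_ , w , _ , _ , Sw) =
    contradiction (subst (n ≤_) (+-identityʳ (card S)) n≤) (<⇒≱ (card< S Sw))
  explore {D} {u} (suc k) S (Su , rev) n≤ | yes (v , w , Sv , vw , Sw) =
    explore k S′ (cong (_∨ u == w) Su , rev′)
      (subst (n ≤_) (trans (+-suc (card S) k) (cong (_+ k) (sym (card-insert S Sw)))) n≤)
    where
    S′ : Fin n → Bool
    S′ z = S z ∨ z == w
    rev′ : ∀ x → S′ x ≡ true → Reversal D S′ u x
    rev′ x S′x with S x in Sx
    ... | true  = reversal-weaken (λ y → ∨-conicalˡ (S y) (y == w)) (rev x Sx)
    ... | false = subst (Reversal D S′ u) (sym (==⇒≡ S′x)) (reversal-extend (rev v Sv) Sv vw Sw)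

-- Balanced orientations

module _ {n : ℕ} {G : Graph n} where

  handshake-closed : ∀ (D : Orientation G) S → Closed D S →
                     2 * ∑[ v < n ] (𝟙 (S v) * out D v) ≤ ∑[ v < n ] (𝟙 (S v) * deg G v)
  handshake-closed D S closed = begin
    2 * ∑[ v < n ] (𝟙 (S v) * out D v)          ≡⟨ cong (2 *_) (sum-cong-≗ out≡) ⟩
    2 * ∑[ v < n ] ∑[ y < n ] T v y             ≡⟨ cong (Tsum +_) (+-identityʳ Tsum) ⟩
    Tsum + Tsum                                 ≡⟨ cong (Tsum +_) (sum-swap T) ⟩
    Tsum + ∑[ v < n ] ∑[ y < n ] T y v
      ≡⟨ sum-distrib-+ (λ v → ∑[ y < n ] T v y) (λ v → ∑[ y < n ] T y v) ⟨
    ∑[ v < n ] (∑[ y < n ] T v y + ∑[ y < n ] T y v)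
      ≡⟨ sum-cong-≗ (λ v → sum-distrib-+ (T v) (λ y → T y v)) ⟨
    ∑[ v < n ] ∑[ y < n ] (T v y + T y v)       ≤⟨ sum-mono-≤ (λ v → sum-mono-≤ (T≤ v)) ⟩
    ∑[ v < n ] ∑[ y < n ] (𝟙 (S v) * 𝟙 (adj G v y))
      ≡⟨ sum-cong-≗ (λ v → *-distribˡ-sum (𝟙 (S v)) (𝟙 ∘ adj G v)) ⟨
    ∑[ v < n ] (𝟙 (S v) * deg G v)                ∎
    where
    open ≤-Reasoning
    T : Fin n → Fin n → ℕ
    T v y = 𝟙 (S v) * (𝟙 (S y) * 𝟙 (arc D v y))
    Tsum = ∑[ v < n ] ∑[ y < n ] T v y
    out≡ : ∀ v → 𝟙 (S v) * out D v ≡ ∑[ y < n ] T v y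
    out≡ v = trans (*-distribˡ-sum (𝟙 (S v)) (𝟙 ∘ arc D v)) (sum-cong-≗ pointwise)
      where
      pointwise : ∀ y → 𝟙 (S v) * 𝟙 (arc D v y) ≡ T v y
      pointwise y with S v in Sv | arc D v y in vy
      ... | false | _     = refl
      ... | true  | false = cong (1 *_) (sym (*-zeroʳ (𝟙 (S y))))
      ... | true  | true  rewrite closed v y Sv vy = refl
    T≤ : ∀ v y → T v y + T y v ≤ 𝟙 (S v) * 𝟙 (adj G v y)
    T≤ v y = subst (T v y + T y v ≤_) (cong (𝟙 (S v) *_) (sym (𝟙-adj D v y)))
                   (bound (S v) (S y) (arc D v y) (arc D y v))
      where
      bound : ∀ s t a b → 𝟙 s * (𝟙 t * 𝟙 a) + 𝟙 t * (𝟙 s * 𝟙 b) ≤ 𝟙 s * (𝟙 a + 𝟙 b)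
      bound false false _ _ = z≤n
      bound false true  _ _ = z≤n
      bound true  false _ _ = z≤n
      bound true  true  a b = ≤-reflexive (begin-equality
        1 * (1 * 𝟙 a) + 1 * (1 * 𝟙 b)  ≡⟨ cong₂ _+_ (*-identityˡ (1 * 𝟙 a)) (*-identityˡ (1 * 𝟙 b)) ⟩
        1 * 𝟙 a + 1 * 𝟙 b              ≡⟨ *-distribˡ-+ 1 (𝟙 a) (𝟙 b) ⟨
        1 * (𝟙 a + 𝟙 b)                ∎)

  Balanced : Orientation G → Set
  Balanced D = ∀ u → 2 * out D u ≤ suc (deg G u)

  excess : Orientation G → ℕ
  excess D = ∑[ z < n ] (2 * out D z ∸ suc (deg G z))

  excess-decreases : ∀ {D S u w} (R : Reversal D S u w) →
                     suc (deg G u) < 2 * out D u → 2 * suc (out D w) ≤ suc (deg G w) → excess (reversed R) < excess D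
  excess-decreases {D} {S} {u} {w} R u-over w-room = sum-mono-< pointwise u at-u
    where
    D′ = reversed R
    shift = out-reversed R
    u≢w : ¬ u ≡ w
    u≢w refl = <-irrefl refl (<-≤-trans u-over (≤-trans (*-monoʳ-≤ 2 (n≤1+n (out D u))) w-room))
    out-u : suc (out D′ u) ≡ out D u
    out-u = begin
      suc (out D′ u)          ≡⟨ +-comm 1 (out D′ u) ⟩
      out D′ u + 1            ≡⟨ cong (λ t → out D′ u + 𝟙 t) (==-refl u) ⟨
      out D′ u + 𝟙 (u == u)   ≡⟨ shift u ⟩
      out D u + 𝟙 (u == w)    ≡⟨ cong (λ t → out D u + 𝟙 t) (==-≢ u≢w) ⟩
      out D u + 0             ≡⟨ +-identityʳ (out D u) ⟩
      out D u                 ∎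
      where open ≡-Reasoning
    at-u : 2 * out D′ u ∸ suc (deg G u) < 2 * out D u ∸ suc (deg G u)
    at-u with suc (deg G u) ≤? 2 * out D′ u
    ... | yes d≤ = ∸-monoˡ-< (*-monoʳ-< 2 (≤-reflexive out-u)) d≤
    ... | no d≰  = subst (_< 2 * out D u ∸ suc (deg G u)) (sym (m≤n⇒m∸n≡0 (<⇒≤ (≰⇒> d≰)))) (m<n⇒0<n∸m u-over)
    pointwise : ∀ z → 2 * out D′ z ∸ suc (deg G z) ≤ 2 * out D z ∸ suc (deg G z)
    pointwise z with z ≟ u | z ≟ w | shift z
    ... | yes refl | _        | _  = <⇒≤ at-u
    ... | no _     | yes refl | eq = ≤-trans (≤-reflexive (m≤n⇒m∸n≡0 room)) z≤n
      where
      room : 2 * out D′ w ≤ suc (deg G w)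
      room = subst (λ t → 2 * t ≤ suc (deg G w)) (trans (+-comm 1 (out D w)) (sym (trans (sym (+-identityʳ _)) eq)))
                   w-room
    ... | no _     | no _     | eq =
      ≤-reflexive (cong (λ t → 2 * t ∸ suc (deg G z)) (+-cancelʳ-≡ 0 (out D′ z) (out D z) eq))

  reduceExcess : ∀ D u → suc (deg G u) < 2 * out D u → Σ[ D′ ∈ Orientation G ] excess D′ < excess D
  reduceExcess D u u-over with explore n (_== u) (explored-singleton D u) (m≤n+m n (card (_== u)))
  ... | S , (Su , rev) , closed with any? (λ w → (S w ≟ᵇ true) ×-dec (2 * suc (out D w) ≤? suc (deg G w)))
  ...   | yes (w , Sw , w-room) = reversed (rev w Sw) , excess-decreases (rev w Sw) u-over w-room
  ...   | no ∄room = contradiction (handshake-closed D S closed) (<⇒≱ overfull)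
    where
    pointwise : ∀ v → 𝟙 (S v) * deg G v ≤ 2 * (𝟙 (S v) * out D v)
    pointwise v with S v in Sv
    ... | false = z≤n
    ... | true  = subst₂ _≤_ (sym (*-identityˡ (deg G v))) (cong (2 *_) (sym (*-identityˡ (out D v))))
      (s≤s⁻¹ (s≤s⁻¹ (subst (suc (suc (deg G v)) ≤_) (*-suc 2 (out D v)) (≰⇒> (∄room ∘ λ room → v , Sv , room)))))
    at-u : 𝟙 (S u) * deg G u < 2 * (𝟙 (S u) * out D u)
    at-u rewrite Su = subst₂ _<_ (sym (*-identityˡ (deg G u))) (cong (2 *_) (sym (*-identityˡ (out D u))))
                                (<-trans (n<1+n (deg G u)) u-over)
    overfull : ∑[ v < n ] (𝟙 (S v) * deg G v) < 2 * ∑[ v < n ] (𝟙 (S v) * out D v)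
    overfull = subst (∑[ v < n ] (𝟙 (S v) * deg G v) <_) (sym (*-distribˡ-sum 2 (λ v → 𝟙 (S v) * out D v)))
                     (sum-mono-< pointwise u at-u)

  balanceFrom : ∀ k D → excess D < k → Σ[ D′ ∈ Orientation G ] Balanced D′
  balanceFrom k D excess< with any? (λ u → suc (deg G u) <? 2 * out D u)
  ... | no ∄over = D , λ u → ≮⇒≥ (∄over ∘ (u ,_))
  balanceFrom (suc k) D excess< | yes (u , u-over) =
    let D′ , decreased = reduceExcess D u u-over in balanceFrom k D′ (<-≤-trans decreased (s≤s⁻¹ excess<))

  orientByIndex : Orientation G
  orientByIndex = record
    { arc      = λ x y → adj G x y ∧ does (x <ᶠ? y)
    ; arc⇒edge = λ x y → ∧-conicalˡ (adj G x y) _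
    ; edge⇒one = one
    }
    where
    one : ∀ x y → adj G x y ≡ true → ((adj G x y ∧ does (x <ᶠ? y)) xor (adj G y x ∧ does (y <ᶠ? x))) ≡ true
    one x y xy rewrite xy | trans (adj-sym G y x) xy with <ᶠ-cmp x y
    ... | tri< x<y _ _ rewrite dec-true (x <ᶠ? y) x<y | dec-false (y <ᶠ? x) (<ᶠ-asym x<y) = refl
    ... | tri≈ _ x≡y _ = contradiction x≡y (adj⇒≢ {G = G} xy)
    ... | tri> _ _ y<x rewrite dec-true (y <ᶠ? x) y<x | dec-false (x <ᶠ? y) (<ᶠ-asym y<x) = refl

  balancedOrientation : Σ[ D ∈ Orientation G ] Balanced D
  balancedOrientation = balanceFrom _ orientByIndex (n<1+n (excess orientByIndex))

-- Vertex sets at pairwise distance at least three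

module _ {n : ℕ} (H : Graph n) where

  Within2 : Fin n → Fin n → Set
  Within2 a x = a ≡ x ⊎ ∃[ y ] adj H a y ≡ true × (y ≡ x ⊎ adj H y x ≡ true)

  within2? : ∀ a x → Dec (Within2 a x)
  within2? a x = (a ≟ x) ⊎-dec any? (λ y → (adj H a y ≟ᵇ true) ×-dec ((y ≟ x) ⊎-dec (adj H y x ≟ᵇ true)))

  within2-sym : ∀ {a x} → Within2 a x → Within2 x a
  within2-sym (inj₁ refl) = inj₁ refl
  within2-sym {a} {x} (inj₂ (y , ay , inj₁ refl))  = inj₂ (a , trans (adj-sym H x a) ay , inj₁ refl)
  within2-sym {a} {x} (inj₂ (y , ay , inj₂ yx))    =
    inj₂ (y , trans (adj-sym H x y) yx , inj₂ (trans (adj-sym H y a) ay))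

  Packing : (Fin n → Bool) → Set
  Packing A = ∀ a b → A a ≡ true → A b ≡ true → Within2 a b → a ≡ b

  Dominated : (Fin n → Bool) → Fin n → Set
  Dominated A x = ∃[ a ] A a ≡ true × Within2 a x

  dominated? : ∀ A x → Dec (Dominated A x)
  dominated? A x = any? (λ a → (A a ≟ᵇ true) ×-dec within2? a x)

  grow : (Fin n → Bool) → Fin n → (Fin n → Bool)
  grow A v with dominated? A v
  ... | yes _ = A
  ... | no _  = λ z → A z ∨ z == v

  grow-⊇ : ∀ A v x → A x ≡ true → grow A v x ≡ true
  grow-⊇ A v x Ax with dominated? A v
  ... | yes _ = Ax
  ... | no _  = cong (_∨ x == v) Ax

  grow-dominates : ∀ A v → Dominated (grow A v) v
  grow-dominates A v with dominated? A v
  ... | yes dom = dom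
  ... | no _    = v , trans (cong (A v ∨_) (==-refl v)) (∨-zeroʳ (A v)) , inj₁ refl

  grow-packing : ∀ A v → Packing A → Packing (grow A v)
  grow-packing A v packing with dominated? A v
  ... | yes _ = packing
  ... | no undominated = λ a b Aa Ab → members (∨-≡true Aa) (∨-≡true Ab)
    where
    members : ∀ {a b} → A a ≡ true ⊎ (a == v) ≡ true → A b ≡ true ⊎ (b == v) ≡ true → Within2 a b → a ≡ b
    members (inj₁ Aa) (inj₁ Ab) near = packing _ _ Aa Ab near
    members {b = b} (inj₁ Aa) (inj₂ b≡v) near with refl ← ==⇒≡ {i = b} b≡v =
      contradiction (_ , Aa , near) undominated
    members {a} (inj₂ a≡v) (inj₁ Ab) near with refl ← ==⇒≡ {i = a} a≡v =
      contradiction (_ , Ab , within2-sym near) undominated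
    members {a} {b} (inj₂ a≡v) (inj₂ b≡v) _ = trans (==⇒≡ {i = a} a≡v) (sym (==⇒≡ {i = b} b≡v))

  foldl-grow-⊇ : ∀ vs A x → A x ≡ true → foldl grow A vs x ≡ true
  foldl-grow-⊇ []       A x Ax = Ax
  foldl-grow-⊇ (v ∷ vs) A x Ax = foldl-grow-⊇ vs (grow A v) x (grow-⊇ A v x Ax)

  foldl-grow-packing : ∀ vs A → Packing A → Packing (foldl grow A vs)
  foldl-grow-packing []       A packing = packing
  foldl-grow-packing (v ∷ vs) A packing = foldl-grow-packing vs (grow A v) (grow-packing A v packing)

  foldl-grow-dominates : ∀ vs A x → x List.∈ vs → Dominated (foldl grow A vs) x
  foldl-grow-dominates (v ∷ vs) A x (here refl) =
    let a , Aa , near = grow-dominates A v in a , foldl-grow-⊇ vs (grow A v) a Aa , near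
  foldl-grow-dominates (v ∷ vs) A x (there x∈vs) = foldl-grow-dominates vs (grow A v) x x∈vs

  maximalPacking : Σ[ A ∈ (Fin n → Bool) ] Packing A × (∀ x → Dominated A x)
  maximalPacking = foldl grow (λ _ → false) (allFin n)
                 , foldl-grow-packing (allFin n) _ (λ _ _ ())
                 , λ x → foldl-grow-dominates (allFin n) _ x (∈-allFin x)

  -- N[y] without a: when a is a neighbour of y, the xor deletes it from N(y).
  punctured : Fin n → Fin n → Fin n → Bool
  punctured a y x = x == y ∨ (adj H y x xor x == a)

  card-punctured : ∀ a y → adj H y a ≡ true → card (punctured a y) ≤ deg H y
  card-punctured a y ya = begin
    card (punctured a y)            ≤⟨ card-∨≤ (_== y) N⁻ ⟩
    card (_== y) + card N⁻          ≡⟨ cong (_+ card N⁻) (card-== y) ⟩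
    1 + card N⁻                     ≡⟨ +-comm 1 (card N⁻) ⟩
    card N⁻ + 1                     ≡⟨ cong (λ t → card N⁻ + 𝟙 t) ya ⟨
    card N⁻ + 𝟙 (adj H y a)         ≡⟨ card-toggle (adj H y) a ⟩
    deg H y + 𝟙 (not (adj H y a))   ≡⟨ cong (λ t → deg H y + 𝟙 (not t)) ya ⟩
    deg H y + 0                     ≡⟨ +-identityʳ (deg H y) ⟩
    deg H y                         ∎
    where
    open ≤-Reasoning
    N⁻ : Fin n → Bool
    N⁻ x = adj H y x xor x == a

  𝟙-within2≤ : ∀ a x → 𝟙 (does (within2? a x)) ≤ 𝟙 (x == a) + ∑[ y < n ] (𝟙 (adj H a y) * 𝟙 (punctured a y x))
  𝟙-within2≤ a x = bound (within2? a x)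
    where
    term : Fin n → ℕ
    term y = 𝟙 (adj H a y) * 𝟙 (punctured a y x)
    hit : ¬ x ≡ a → Within2 a x → 1 ≤ sum term
    hit x≢a (inj₁ a≡x)              = contradiction (sym a≡x) x≢a
    hit x≢a (inj₂ (y , ay , y≈x)) =
      ≤-trans (subst₂ (λ p q → 1 ≤ 𝟙 p * 𝟙 q) (sym ay) (sym (in-punctured y≈x)) (s≤s z≤n)) (≤-sum term y)
      where
      in-punctured : y ≡ x ⊎ adj H y x ≡ true → punctured a y x ≡ true
      in-punctured (inj₁ refl) = cong (_∨ (adj H y y xor y == a)) (==-refl y)
      in-punctured (inj₂ yx)   = trans (cong₂ (λ p q → x == y ∨ (p xor q)) yx (==-≢ x≢a)) (∨-zeroʳ (x == y))
    bound : (d : Dec (Within2 a x)) → 𝟙 (does d) ≤ 𝟙 (x == a) + sum term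
    bound (no _)     = z≤n
    bound (yes near) = split (x ≟ a)
      where
      split : Dec (x ≡ a) → 1 ≤ 𝟙 (x == a) + sum term
      split (yes x≡a) = subst (λ b → 1 ≤ 𝟙 b + sum term) (sym (dec-true (x ≟ a) x≡a)) (s≤s z≤n)
      split (no x≢a)  = subst (λ b → 1 ≤ 𝟙 b + sum term) (sym (==-≢ x≢a)) (hit x≢a near)

  ball-bound : ∀ {Δ} → (∀ u → deg H u ≤ Δ) → ∀ a → card (λ x → does (within2? a x)) ≤ suc (Δ * Δ)
  ball-bound {Δ} deg≤Δ a = begin
    card (λ x → does (within2? a x))
      ≤⟨ sum-mono-≤ (𝟙-within2≤ a) ⟩
    ∑[ x < n ] (𝟙 (x == a) + ∑[ y < n ] term y x)
      ≡⟨ sum-distrib-+ (λ x → 𝟙 (x == a)) (λ x → ∑[ y < n ] term y x) ⟩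
    card (_== a) + ∑[ x < n ] ∑[ y < n ] term y x
      ≡⟨ cong₂ _+_ (card-== a) (sum-swap (λ x y → term y x)) ⟩
    1 + ∑[ y < n ] ∑[ x < n ] term y x
      ≡⟨ cong suc (sum-cong-≗ (λ y → *-distribˡ-sum (𝟙 (adj H a y)) (𝟙 ∘ punctured a y))) ⟨
    1 + ∑[ y < n ] (𝟙 (adj H a y) * card (punctured a y))
      ≤⟨ s≤s (sum-mono-≤ neighbour) ⟩
    1 + ∑[ y < n ] (𝟙 (adj H a y) * Δ)
      ≡⟨ cong suc (*-distribʳ-sum Δ (𝟙 ∘ adj H a)) ⟨
    1 + deg H a * Δ
      ≤⟨ s≤s (*-monoˡ-≤ Δ (deg≤Δ a)) ⟩
    suc (Δ * Δ) ∎
    where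
    open ≤-Reasoning
    term : Fin n → Fin n → ℕ
    term y x = 𝟙 (adj H a y) * 𝟙 (punctured a y x)
    neighbour : ∀ y → 𝟙 (adj H a y) * card (punctured a y) ≤ 𝟙 (adj H a y) * Δ
    neighbour y with adj H a y in ay
    ... | false = z≤n
    ... | true  = *-monoʳ-≤ 1 (≤-trans (card-punctured a y (trans (adj-sym H y a) ay)) (deg≤Δ y))

-- Orienting towards a packing

half-bound : ∀ {c o d Δ} → c ≤ 1 → 2 * o ≤ suc d → c + d ≤ Δ → c + o ≤ suc (Δ / 2)
half-bound {c} {o} {d} {Δ} c≤1 o-bal cd≤Δ = begin
  c + o               ≡⟨ m*n/n≡m (c + o) 2 ⟨
  (c + o) * 2 / 2     ≤⟨ /-monoˡ-≤ 2 (doubled c≤1 cd≤Δ) ⟩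
  (2 + Δ) / 2         ≡⟨ m/n≡1+[m∸n]/n {2 + Δ} {2} (s≤s (s≤s z≤n)) ⟩
  suc (Δ / 2)         ∎
  where
  open ≤-Reasoning
  doubled : ∀ {c} → c ≤ 1 → c + d ≤ Δ → (c + o) * 2 ≤ 2 + Δ
  doubled z≤n       d≤Δ  = ≤-trans (≤-reflexive (*-comm o 2)) (≤-trans o-bal (≤-trans (s≤s d≤Δ) (n≤1+n _)))
  doubled (s≤s z≤n) 1d≤Δ = s≤s (s≤s (≤-trans (≤-reflexive (*-comm o 2)) (≤-trans o-bal 1d≤Δ)))

module _ {n : ℕ} (H : Graph n) (A : Fin n → Bool) where

  -- H − A, with the vertices of A kept as isolated vertices.
  withoutVertices : Graph n
  withoutVertices = record
    { adj   = λ u v → (not (A u) ∧ not (A v)) ∧ adj H u v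
    ; sym   = λ u v → cong₂ _∧_ (∧-comm (not (A u)) (not (A v))) (adj-sym H u v)
    ; irref = λ u → trans (cong ((not (A u) ∧ not (A u)) ∧_) (irref H u)) (∧-zeroʳ _)
    }

  Independent : Set
  Independent = ∀ u v → A u ≡ true → A v ≡ true → ¬ adj H u v ≡ true

  module _ (independent : Independent) (D : Orientation withoutVertices) where

    no-arc-from : ∀ {u} v → A u ≡ true → arc D u v ≡ false
    no-arc-from {u} v Au with arc D u v in uv
    ... | true  with () ← trans (sym (arc⇒edge D u v uv)) (cong (λ p → (not p ∧ not (A v)) ∧ adj H u v) Au)
    ... | false = refl

    orientTowards : Orientation H
    orientTowards = record
      { arc      = λ u v → (adj H u v ∧ A v) ∨ arc D u v
      ; arc⇒edge = λ u v uv → [ ∧-conicalˡ (adj H u v) (A v)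
                              , ∧-conicalʳ (not (A u) ∧ not (A v)) (adj H u v) ∘ arc⇒edge D u v
                              ]′ (∨-≡true uv)
      ; edge⇒one = one
      }
      where
      one : ∀ u v → adj H u v ≡ true → ((adj H u v ∧ A v) ∨ arc D u v) xor ((adj H v u ∧ A u) ∨ arc D v u) ≡ true
      one u v uv with A u in Au | A v in Av
      ... | true  | true  = contradiction uv (independent u v Au Av)
      ... | true  | false rewrite uv | trans (adj-sym H v u) uv | no-arc-from v Au = refl
      ... | false | true  rewrite uv | trans (adj-sym H v u) uv | no-arc-from u Av = refl
      ... | false | false rewrite uv | trans (adj-sym H v u) uv =
        edge⇒one D u v (trans (cong₂ (λ p q → (not p ∧ not q) ∧ adj H u v) Au Av) uv)

    out-orientTowards-∈ : ∀ u → A u ≡ true → out orientTowards u ≡ 0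
    out-orientTowards-∈ u Au = sum-zero no-arc
      where
      no-arc : ∀ v → 𝟙 ((adj H u v ∧ A v) ∨ arc D u v) ≡ 0
      no-arc v rewrite no-arc-from v Au with adj H u v in uv | A v in Av
      ... | true  | true  = contradiction uv (independent u v Au Av)
      ... | true  | false = refl
      ... | false | _     = refl

    out-orientTowards-∉ : ∀ u → out orientTowards u ≤ card (λ v → adj H u v ∧ A v) + out D u
    out-orientTowards-∉ u = card-∨≤ (λ v → adj H u v ∧ A v) (arc D u)

  deg-withoutVertices : ∀ u → A u ≡ false → deg H u ≡ card (λ v → adj H u v ∧ A v) + deg withoutVertices u
  deg-withoutVertices u Au =
    trans (sum-cong-≗ split) (sum-distrib-+ (λ v → 𝟙 (adj H u v ∧ A v)) (𝟙 ∘ adj withoutVertices u))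
    where
    split : ∀ v → 𝟙 (adj H u v) ≡ 𝟙 (adj H u v ∧ A v) + 𝟙 ((not (A u) ∧ not (A v)) ∧ adj H u v)
    split v rewrite Au with adj H u v | A v
    ... | true  | true  = refl
    ... | true  | false = refl
    ... | false | true  = refl
    ... | false | false = refl

module _ {n : ℕ} (H : Graph n) {A : Fin n → Bool} (packing : Packing H A) where

  packing⇒independent : Independent H A
  packing⇒independent u v Au Av uv = adj⇒≢ {G = H} uv (packing u v Au Av (inj₂ (v , uv , inj₁ refl)))

  packing⇒neighbours≤1 : ∀ u → card (λ v → adj H u v ∧ A v) ≤ 1
  packing⇒neighbours≤1 u = card≤1 _ λ x y ux uy →
    packing x y (∧-conicalʳ (adj H u x) (A x) ux) (∧-conicalʳ (adj H u y) (A y) uy)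
      (inj₂ (u , trans (adj-sym H x u) (∧-conicalˡ (adj H u x) (A x) ux) , inj₂ (∧-conicalˡ (adj H u y) (A y) uy)))

  balancedRemainder : Σ[ D ∈ Orientation (withoutVertices H A) ] Balanced D
  balancedRemainder = balancedOrientation

  towardsPacking : Orientation H
  towardsPacking = orientTowards H A packing⇒independent (proj₁ balancedRemainder)

  out-towardsPacking-∈ : ∀ u → A u ≡ true → out towardsPacking u ≡ 0
  out-towardsPacking-∈ = out-orientTowards-∈ H A packing⇒independent (proj₁ balancedRemainder)

  out-towardsPacking≤ : ∀ {Δ} → (∀ u → deg H u ≤ Δ) → ∀ u → out towardsPacking u ≤ suc (Δ / 2)
  out-towardsPacking≤ {Δ} deg≤Δ u with A u in Au
  ... | true  = ≤-trans (≤-reflexive (out-towardsPacking-∈ u Au)) z≤n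
  ... | false = ≤-trans (out-orientTowards-∉ H A packing⇒independent (proj₁ balancedRemainder) u)
                        (half-bound (packing⇒neighbours≤1 u) (proj₂ balancedRemainder u)
                                    (subst (_≤ Δ) (deg-withoutVertices H A u Au) (deg≤Δ u)))

dominating-packing-size : ∀ {n} (H : Graph n) {Δ} → (∀ u → deg H u ≤ Δ) →
                          ∀ {A} → (∀ x → Dominated H A x) → n ≤ card A * suc (Δ * Δ)
dominating-packing-size H deg≤Δ {A} dominated = double-count A (λ a x → does (within2? H a x))
  (λ x → let a , Aa , near = dominated x in a , Aa , dec-true (within2? H a x) near)
  (ball-bound H deg≤Δ)

lemma2p4 : (n : ℕ) (H : Graph n) (Δ : ℕ) → maxDegree H ≡ Δ →
    Σ (Orientation H) λ D →
    (∀ u → outDegree D u ≤ suc (Δ / 2)) ×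
    (∃[ A ] (n ≤ ∣ A ∣ * (Δ ^ 2 + 1) × (∀ u → u ∈ A → outDegree D u ≡ 0)))
lemma2p4 n H Δ maxDegree≡Δ with maximalPacking H
... | A , packing , dominated =
    towardsPacking H packing
  , (λ u → subst (_≤ suc (Δ / 2)) (sym (outDegree≡out u)) (out-towardsPacking≤ H packing deg≤Δ u))
  , tabulateᵛ A
  , subst₂ (λ a b → n ≤ a * b) (sym (∣tabulateᵛ∣ A)) Δ²+1 (dominating-packing-size H deg≤Δ dominated)
  , λ u u∈A → trans (outDegree≡out u) (out-towardsPacking-∈ H packing u (A-member u∈A))
  where
  deg≤Δ : ∀ u → deg H u ≤ Δ
  deg≤Δ u = subst (deg H u ≤_) maxDegree≡Δ (deg≤maxDegree H u)
  outDegree≡out : ∀ u → outDegree (towardsPacking H packing) u ≡ out (towardsPacking H packing) u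
  outDegree≡out u = countTrue≡card (arc (towardsPacking H packing) u)
  A-member : ∀ {u} → u ∈ tabulateᵛ A → A u ≡ true
  A-member {u} u∈A = trans (sym (lookup∘tabulate A u)) ([]=⇒lookup u∈A)
  Δ²+1 : suc (Δ * Δ) ≡ Δ ^ 2 + 1
  Δ²+1 = trans (cong (λ m → suc (Δ * m)) (sym (*-identityʳ Δ))) (+-comm 1 (Δ ^ 2))
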